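{- Let $f$ be the function assigning to a CacAP instance $(G=(V,E),L)$ the number of vertices $v\in V$ that are not leaves of $G$ but are endpoints of some link in $L$. Then for any Leaf-to-Leaf CacAP instance $\mathcal I$, any $\gamma\ge0$ and any positive integer $k$, $$\max_{\mathcal S\text{ a }(\gamma,k)\text{ -splitting of }\mathcal I}\ \sum_{\mathcal J\text{ split minor of }\mathcal S} f(\mathcal J)\ \le\ \gamma.$$
   Context: A cactus is a connected multigraph in which every edge lies in exactly one cycle (pairs of parallel edges count as cycles). A CacAP instance $(G,L)$: cactus $G=(V,E)$, links $L\subseteq\binom V2$. Leaves are degree-$2$ vertices; Leaf-to-Leaf means every link joins two leaves. $k$-wide: there is a vertex $r$ such that every connected component of $G-r$ contains at most $k$ leaves. Contracting a vertex set $S$ replaces $S$ by one vertex (edges/links inside $S$ removed, other endpoints in $S$ redirected). Splitting at $C\subseteq V$ with $|\delta_E(C)|=2$ produces two instances: one contracting $V\setminus C$, the other contracting $C$. Contracting a link $\{u,v\}$ means contracting the set of vertices lying on every $u$-$v$ path in $G$. A $(\gamma,k)$-splitting of $\mathcal I$ is a sequence of splitting operations, link-contraction operations and link deletions (applied to $\mathcal I$ and to instances produced along the way) such that all resulting final instances, called split minors, are $k$-wide, and the number of contraction operations is at most $\gamma$. -}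

module Defs where

open import Data.Nat using (ℕ; zero; suc; _+_; _≤_; _≡ᵇ_)
open import Data.Nat.DivMod using (_%_; m%n<n)
open import Data.Fin using (Fin; toℕ; fromℕ<) renaming (_≟_ to _≟F_)
open import Data.Bool using (Bool; true; false; not; _∧_; _∨_; _xor_)
open import Data.List using (List; []; _∷_; length; lookup; allFin; removeAt; filterᵇ; map)
open import Data.Nat.ListAction using (sum)
open import Data.Bool.ListAction using (any)
open import Data.List.Membership.Propositional using (_∈_)
open import Data.List.Relation.Unary.All using (All)
open import Data.List.Relation.Unary.Unique.Propositional using (Unique)
open import Data.Product using (Σ; ∃; _×_; _,_; proj₁; proj₂)
open import Data.Sum using (_⊎_)
open import Function.Definitions using (Injective)
open import Function.Bundles using (_⇔_)
open import Relation.Binary.PropositionalEquality using (_≡_; _≢_)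
open import Relation.Nullary using (yes; no)
open import Relation.Nullary.Decidable using (⌊_⌋)

-- CacAP instances: a multigraph on vertex set Fin n with an edge list
-- (multigraph: repeated entries = parallel edges) and a link list.
-- A pair (a , b) represents the unordered pair {a, b}.

record Instance : Set where
  constructor inst
  field
    n : ℕ
    E : List (Fin n × Fin n)
    L : List (Fin n × Fin n)
open Instance public

module _ (I : Instance) where

  deg : Fin (n I) → ℕ
  deg v = sum (map (λ e → ind (proj₁ e) + ind (proj₂ e)) (E I))
    where
    ind : Fin (n I) → ℕ
    ind a with a ≟F v
    ... | yes _ = 1
    ... | no _  = 0

  Leaf : Fin (n I) → Set
  Leaf v = deg v ≡ 2

  isLeaf : Fin (n I) → Bool
  isLeaf v = deg v ≡ᵇ 2

  Adj : Fin (n I) → Fin (n I) → Set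
  Adj u w = ((u , w) ∈ E I) ⊎ ((w , u) ∈ E I)

  data Walk : Fin (n I) → Fin (n I) → List (Fin (n I)) → Set where
    here : ∀ {u} → Walk u u (u ∷ [])
    step : ∀ {u w v xs} → Adj u w → Walk w v xs → Walk u v (u ∷ xs)

  Connected : Set
  Connected = ∀ u v → ∃ λ xs → Walk u v xs

  OnEveryPath : Fin (n I) → Fin (n I) → Fin (n I) → Set
  OnEveryPath u v x = ∀ xs → Walk u v xs → Unique xs → x ∈ xs

  Joins : Fin (length (E I)) → Fin (n I) → Fin (n I) → Set
  Joins j a b = (lookup (E I) j ≡ (a , b)) ⊎ (lookup (E I) j ≡ (b , a))

  next : ∀ {p} → Fin (suc p) → Fin (suc p)
  next {p} i = fromℕ< (m%n<n (suc (toℕ i)) (suc p))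

  record Cycle : Set where
    field
      m     : ℕ
      vs    : Fin (suc (suc m)) → Fin (n I)
      es    : Fin (suc (suc m)) → Fin (length (E I))
      vsInj : Injective _≡_ _≡_ vs
      esInj : Injective _≡_ _≡_ es
      joins : ∀ i → Joins (es i) (vs i) (vs (next i))

  InCycle : Fin (length (E I)) → Cycle → Set
  InCycle j C = ∃ λ i → Cycle.es C i ≡ j

  SameCycle : Cycle → Cycle → Set
  SameCycle C D = ∀ j → InCycle j C ⇔ InCycle j D

  Cactus : Set
  Cactus = Connected ×
    (∀ j → (∃ λ C → InCycle j C) × (∀ C D → InCycle j C → InCycle j D → SameCycle C D))

  LeafToLeaf : Set
  LeafToLeaf = All (λ l → Leaf (proj₁ l) × Leaf (proj₂ l)) (L I)

  ReachAvoid : Fin (n I) → Fin (n I) → Fin (n I) → Set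
  ReachAvoid r u v = ∃ λ xs → Walk u v xs × All (λ x → x ≢ r) xs

  -- k-wide: some r such that every component of G - r has ≤ k leaves (of G)
  Wide : ℕ → Set
  Wide k = ∃ λ r → ∀ u → u ≢ r → ∀ (vs : List (Fin (n I))) → Unique vs →
    All (λ v → Leaf v × ReachAvoid r u v) vs → length vs ≤ k

  cutSize : (Fin (n I) → Bool) → ℕ
  cutSize C = length (filterᵇ (λ e → C (proj₁ e) xor C (proj₂ e)) (E I))

  isLinkEnd : Fin (n I) → Bool
  isLinkEnd v = any (λ l → ⌊ proj₁ l ≟F v ⌋ ∨ ⌊ proj₂ l ≟F v ⌋) (L I)

  f : ℕ
  f = length (filterᵇ (λ v → not (isLeaf v) ∧ isLinkEnd v) (allFin (n I)))

contractList : ∀ {n m} → (Fin n → Fin m) → List (Fin n × Fin n) → List (Fin m × Fin m)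
contractList φ [] = []
contractList φ ((a , b) ∷ xs) with φ a ≟F φ b
... | yes _ = contractList φ xs
... | no _  = (φ a , φ b) ∷ contractList φ xs

-- J is (an isomorphic copy of) the instance obtained from I by contracting S
record Contraction (I : Instance) (S : Fin (n I) → Bool) (J : Instance) : Set where
  field
    φ     : Fin (n I) → Fin (n J)
    surj  : ∀ y → ∃ λ x → φ x ≡ y
    fibre : ∀ x y → (φ x ≡ φ y) ⇔ ((x ≡ y) ⊎ ((S x ≡ true) × (S y ≡ true)))
    edges : E J ≡ contractList φ (E I)
    links : L J ≡ contractList φ (L I)

deleteLink : (I : Instance) → Fin (length (L I)) → Instance
deleteLink I i = inst (n I) (E I) (removeAt (L I) i)

-- (·,k)-splittings of an instance, as a derivation tree whose leaves are
-- the split minors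
data Splitting (k : ℕ) : Instance → Set₁ where
  final   : ∀ {I} → Wide I k → Splitting k I
  split   : ∀ {I J₁ J₂} (C : Fin (n I) → Bool) → cutSize I C ≡ 2 →
            Contraction I (λ x → not (C x)) J₁ → Contraction I C J₂ →
            Splitting k J₁ → Splitting k J₂ → Splitting k I
  contr   : ∀ {I J} (i : Fin (length (L I))) (S : Fin (n I) → Bool) →
            (∀ x → (S x ≡ true) ⇔ OnEveryPath I (proj₁ (lookup (L I) i)) (proj₂ (lookup (L I) i)) x) →
            Contraction I S J → Splitting k J → Splitting k I
  delete  : ∀ {I} (i : Fin (length (L I))) → Splitting k (deleteLink I i) → Splitting k I

contractions : ∀ {k I} → Splitting k I → ℕ
contractions (final _) = 0
contractions (split _ _ _ _ s t) = contractions s + contractions t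
contractions (contr _ _ _ _ s) = suc (contractions s)
contractions (delete _ s) = contractions s

sumF : ∀ {k I} → Splitting k I → ℕ
sumF {I = I} (final _) = f I
sumF (split _ _ _ _ s t) = sumF s + sumF t
sumF (contr _ _ _ _ s) = sumF s
sumF (delete _ s) = sumF s

-- Initially every link endpoint is a leaf, so f vanishes; it then suffices that each
-- operation of a splitting raises the total of f over the current instances by at most
-- the number of link contractions it performs. Deleting a link only removes link
-- endpoints. Contracting a set S leaves every vertex outside S unchanged (its degree is
-- preserved because a cactus has no loops, and its links survive), so f grows by at most
-- one, for the new vertex. Splitting along a 2-cut C contracts each side into a vertex of
-- degree 2, i.e. a leaf, so every vertex counted in a split minor is a counted vertex of
-- the original instance, lying in C for one minor and outside C for the other.
module Submission where

open import Defs
open import Algebra.Properties.CommutativeSemigroup using (interchange)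
open import Data.Bool using (Bool; true; false; not; _∧_; _∨_; _xor_; T; if_then_else_)
open import Data.Bool.Properties
  using (T-≡; T-not-≡; T-∧; not-distribˡ-xor; not-distribʳ-xor; not-involutive)
open import Data.Empty using (⊥; ⊥-elim)
open import Data.Fin using (Fin; toℕ) renaming (_≟_ to _≟F_)
open import Data.Fin.Properties using (toℕ-fromℕ<; toℕ<n)
open import Data.List using (List; []; _∷_; length; lookup; allFin; removeAt; filterᵇ; map)
open import Data.List.Membership.Propositional using (_∈_)
open import Data.List.Membership.Propositional.Properties using (∈-allFin; ∈-filter⁺; ∈-filter⁻; ∈-map⁻)
open import Data.List.Properties using (length-map; length-removeAt′; map-cong; filter-none)
open import Data.List.Relation.Binary.Subset.Propositional using (_⊆_)
open import Data.List.Relation.Unary.All as All using (All; []; _∷_)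
open import Data.List.Relation.Unary.AllPairs using (_∷_)
open import Data.List.Relation.Unary.Any as Any using (Any; here; there; _─_)
open import Data.List.Relation.Unary.Any.Properties using (any⁺; any⁻; lookup-index)
open import Data.List.Relation.Unary.Unique.Propositional using (Unique)
import Data.List.Relation.Unary.Unique.Propositional.Properties as Unique
open import Data.Nat using (ℕ; suc; _+_; _≤_; _<_; _≡ᵇ_; z≤n; s≤s)
open import Data.Nat.DivMod using (_%_; m<n⇒m%n≡m; n%n≡0)
open import Data.Nat.ListAction using (sum)
open import Data.Nat.Properties
  using (≤-antisym; ≮⇒≥; _<?_; 1+n≢n; 0≢1+n; +-suc; +-comm; +-mono-≤; +-monoˡ-≤; m≤m+n;
         +-commutativeSemigroup; module ≤-Reasoning)
open import Data.Product using (_×_; _,_; proj₁; proj₂)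
open import Data.Sum as Sum using (_⊎_; inj₁; inj₂)
open import Function using (_∘_; id; Injective)
open import Function.Bundles using (Equivalence; _⇔_; mk⇔)
open import Relation.Binary.PropositionalEquality
open import Relation.Nullary using (¬_; yes; no)
open import Relation.Nullary.Decidable using (⌊_⌋)
open import Relation.Nullary.Decidable.Core using (T?)

open Equivalence using (to; from)

private
  variable
    A : Set
    m m′ : ℕ

∈-─⁺ : ∀ {x z : A} {ys} (x∈ys : x ∈ ys) → z ∈ ys → x ≢ z → z ∈ (ys ─ x∈ys)
∈-─⁺ (here refl) (here refl) x≢z = ⊥-elim (x≢z refl)
∈-─⁺ (here refl) (there z∈ys) _ = z∈ys
∈-─⁺ (there x∈ys) (here refl) _ = here refl
∈-─⁺ (there x∈ys) (there z∈ys) x≢z = there (∈-─⁺ x∈ys z∈ys x≢z)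

Unique⇒length≤ : ∀ {xs ys : List A} → Unique xs → xs ⊆ ys → length xs ≤ length ys
Unique⇒length≤ {xs = []} _ _ = z≤n
Unique⇒length≤ {xs = x ∷ xs} {ys} (x∉xs ∷ xs!) xs⊆ys = begin
  suc (length xs)          ≤⟨ s≤s (Unique⇒length≤ xs! xs⊆ys─x) ⟩
  suc (length (ys ─ x∈ys)) ≡⟨ length-removeAt′ ys (Any.index x∈ys) ⟨
  length ys                ∎
  where
  open ≤-Reasoning
  x∈ys : x ∈ ys
  x∈ys = xs⊆ys (here refl)
  xs⊆ys─x : xs ⊆ (ys ─ x∈ys)
  xs⊆ys─x z∈xs = ∈-─⁺ x∈ys (xs⊆ys (there z∈xs)) (All.lookup x∉xs z∈xs)

Unique⇒length≤1 : ∀ {xs : List A} → Unique xs → (∀ {x y} → x ∈ xs → y ∈ xs → x ≡ y) → length xs ≤ 1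
Unique⇒length≤1 {xs = []} _ _ = z≤n
Unique⇒length≤1 {xs = _ ∷ []} _ _ = s≤s z≤n
Unique⇒length≤1 {xs = _ ∷ _ ∷ _} ((x≢y ∷ _) ∷ _) same = ⊥-elim (x≢y (same (here refl) (there (here refl))))

indicator : Bool → ℕ
indicator b = if b then 1 else 0

indicator-xor : ∀ s t → (s ≡ true → t ≡ true → ⊥) → indicator s + indicator t ≡ indicator (s xor t)
indicator-xor true true both = ⊥-elim (both refl refl)
indicator-xor true false _ = refl
indicator-xor false true _ = refl
indicator-xor false false _ = refl

not-xor-not : ∀ s t → not s xor not t ≡ s xor t
not-xor-not s t = begin
  not s xor not t   ≡⟨ not-distribˡ-xor s (not t) ⟨
  not (s xor not t) ≡⟨ cong not (not-distribʳ-xor s t) ⟨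
  not (not (s xor t)) ≡⟨ not-involutive (s xor t) ⟩
  s xor t           ∎
  where open ≡-Reasoning

length-filterᵇ : (p : A → Bool) (xs : List A) → length (filterᵇ p xs) ≡ sum (map (λ x → indicator (p x)) xs)
length-filterᵇ p [] = refl
length-filterᵇ p (x ∷ xs) with p x
... | true = cong suc (length-filterᵇ p xs)
... | false = length-filterᵇ p xs

length-filterᵇ-partition : (p c : A → Bool) (xs : List A) →
  length (filterᵇ p xs) ≡ length (filterᵇ (λ x → p x ∧ c x) xs) + length (filterᵇ (λ x → p x ∧ not (c x)) xs)
length-filterᵇ-partition p c [] = refl
length-filterᵇ-partition p c (x ∷ xs) with p x | c x
... | false | _ = length-filterᵇ-partition p c xs
... | true | true = cong suc (length-filterᵇ-partition p c xs)
... | true | false = trans (cong suc (length-filterᵇ-partition p c xs)) (sym (+-suc _ _))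

count : (Fin m → Bool) → ℕ
count {m} p = length (filterᵇ p (allFin m))

count-≤-injection : {p : Fin m → Bool} {q : Fin m′ → Bool} (g : Fin m → Fin m′) → Injective _≡_ _≡_ g →
  (∀ {x} → T (p x) → T (q (g x))) → count p ≤ count q
count-≤-injection {m} {m′} {p} {q} g g-injective p⇒q = begin
  count p                               ≡⟨ length-map g (filterᵇ p (allFin m)) ⟨
  length (map g (filterᵇ p (allFin m))) ≤⟨ Unique⇒length≤ image! image⊆ ⟩
  count q                               ∎
  where
  open ≤-Reasoning
  image! : Unique (map g (filterᵇ p (allFin m)))
  image! = Unique.map⁺ g-injective (Unique.filter⁺ (T? ∘ p) (Unique.allFin⁺ m))
  image⊆ : map g (filterᵇ p (allFin m)) ⊆ filterᵇ q (allFin m′)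
  image⊆ y∈ with ∈-map⁻ g y∈
  ... | x , x∈ , refl = ∈-filter⁺ (T? ∘ q) (∈-allFin (g x)) (p⇒q (proj₂ (∈-filter⁻ (T? ∘ p) {xs = allFin m} x∈)))

count-≤1 : {p : Fin m → Bool} → (∀ {x y} → T (p x) → T (p y) → x ≡ y) → count p ≤ 1
count-≤1 {m} {p} same = Unique⇒length≤1 (Unique.filter⁺ (T? ∘ p) (Unique.allFin⁺ m))
  (λ x∈ y∈ → same (proj₂ (∈-filter⁻ (T? ∘ p) {xs = allFin m} x∈)) (proj₂ (∈-filter⁻ (T? ∘ p) {xs = allFin m} y∈)))

count-none : {p : Fin m → Bool} → (∀ x → ¬ T (p x)) → count p ≡ 0
count-none {m} {p} none = cong length (filter-none (T? ∘ p) (All.universal none (allFin m)))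

Loopless : List (Fin m × Fin m) → Set
Loopless = All (λ e → proj₁ e ≢ proj₂ e)

contractList-loopless : (φ : Fin m → Fin m′) (es : List (Fin m × Fin m)) → Loopless (contractList φ es)
contractList-loopless φ [] = []
contractList-loopless φ ((a , b) ∷ es) with φ a ≟F φ b
... | yes _ = contractList-loopless φ es
... | no φa≢φb = φa≢φb ∷ contractList-loopless φ es

sum-map-contractList : (φ : Fin m → Fin m′) (w : Fin m × Fin m → ℕ) (w′ : Fin m′ × Fin m′ → ℕ) →
  (∀ {a b} → a ≢ b → φ a ≡ φ b → w (a , b) ≡ 0) →
  (∀ {a b} → φ a ≢ φ b → w′ (φ a , φ b) ≡ w (a , b)) →
  ∀ {es} → Loopless es → sum (map w′ (contractList φ es)) ≡ sum (map w es)
sum-map-contractList φ w w′ collapsed kept [] = refl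
sum-map-contractList φ w w′ collapsed kept {(a , b) ∷ es} (a≢b ∷ es-loopless) with φ a ≟F φ b
... | yes φa≡φb = trans ih (cong (_+ sum (map w es)) (sym (collapsed a≢b φa≡φb)))
  where ih = sum-map-contractList φ w w′ collapsed kept es-loopless
... | no φa≢φb = cong₂ _+_ (kept φa≢φb) (sum-map-contractList φ w w′ collapsed kept es-loopless)

Any-contractList⁻ : {P : Fin m′ × Fin m′ → Set} (φ : Fin m → Fin m′) (es : List (Fin m × Fin m)) →
  Any P (contractList φ es) → Any (λ e → P (φ (proj₁ e) , φ (proj₂ e))) es
Any-contractList⁻ φ ((a , b) ∷ es) p with φ a ≟F φ b
... | yes _ = there (Any-contractList⁻ φ es p)
Any-contractList⁻ φ ((a , b) ∷ es) (here pab) | no _ = here pab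
Any-contractList⁻ φ ((a , b) ∷ es) (there p) | no _ = there (Any-contractList⁻ φ es p)

Any-removeAt⁻ : {P : A → Set} (xs : List A) (i : Fin (length xs)) → Any P (removeAt xs i) → Any P xs
Any-removeAt⁻ (x ∷ xs) Fin.zero p = there p
Any-removeAt⁻ (x ∷ xs) (Fin.suc i) (here px) = here px
Any-removeAt⁻ (x ∷ xs) (Fin.suc i) (there p) = there (Any-removeAt⁻ xs i p)

incidence : Fin m → Fin m → ℕ
incidence v a = indicator ⌊ a ≟F v ⌋

incidence-≢ : ∀ {v a : Fin m} → a ≢ v → incidence v a ≡ 0
incidence-≢ {v = v} {a} a≢v with a ≟F v
... | yes a≡v = ⊥-elim (a≢v a≡v)
... | no _ = refl

endsAt : Fin m → Fin m × Fin m → ℕ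
endsAt v e = incidence v (proj₁ e) + incidence v (proj₂ e)

-- The left-hand side is the incidence count local to deg, which cannot be named here;
-- it is solved from the use of endsAt-agrees in deg≡sum-endsAt.
endsAt-agrees : ∀ I v (e : Fin (n I) × Fin (n I)) → _ ≡ endsAt v e

deg≡sum-endsAt : ∀ I v → deg I v ≡ sum (map (endsAt v) (E I))
deg≡sum-endsAt I v = cong sum (map-cong (endsAt-agrees I v) (E I))

endsAt-agrees I v (a , b) with a ≟F v | b ≟F v
... | yes _ | yes _ = refl
... | yes _ | no _ = refl
... | no _ | yes _ = refl
... | no _ | no _ = refl

crosses : (Fin m → Bool) → Fin m × Fin m → ℕ
crosses S e = indicator (S (proj₁ e) xor S (proj₂ e))

cutSize≡sum-crosses : ∀ I S → cutSize I S ≡ sum (map (crosses S) (E I))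
cutSize≡sum-crosses I S = length-filterᵇ (λ e → S (proj₁ e) xor S (proj₂ e)) (E I)

cutSize-complement : ∀ I C → cutSize I (λ x → not (C x)) ≡ cutSize I C
cutSize-complement I C = begin
  cutSize I (λ x → not (C x))              ≡⟨ cutSize≡sum-crosses I (λ x → not (C x)) ⟩
  sum (map (crosses (λ x → not (C x))) (E I)) ≡⟨ cong sum (map-cong crosses-complement (E I)) ⟩
  sum (map (crosses C) (E I))              ≡⟨ cutSize≡sum-crosses I C ⟨
  cutSize I C                              ∎
  where
  open ≡-Reasoning
  crosses-complement : ∀ e → crosses (λ x → not (C x)) e ≡ crosses C e
  crosses-complement e = cong indicator (not-xor-not (C (proj₁ e)) (C (proj₂ e)))

HasEnd : Fin m → Fin m × Fin m → Set
HasEnd v l = proj₁ l ≡ v ⊎ proj₂ l ≡ v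

isEndOf : Fin m → Fin m × Fin m → Bool
isEndOf v l = ⌊ proj₁ l ≟F v ⌋ ∨ ⌊ proj₂ l ≟F v ⌋

T-isEndOf⇔HasEnd : (v : Fin m) (l : Fin m × Fin m) → T (isEndOf v l) ⇔ HasEnd v l
T-isEndOf⇔HasEnd v (a , b) with a ≟F v | b ≟F v
... | yes a≡v | _ = mk⇔ (λ _ → inj₁ a≡v) _
... | no _ | yes b≡v = mk⇔ (λ _ → inj₂ b≡v) _
... | no a≢v | no b≢v = mk⇔ (λ ()) Sum.[ a≢v , b≢v ]

isLinkEnd⇒Any : ∀ I {v} → T (isLinkEnd I v) → Any (HasEnd v) (L I)
isLinkEnd⇒Any I {v} h = Any.map (to (T-isEndOf⇔HasEnd v _)) (any⁻ (isEndOf v) (L I) h)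

Any⇒isLinkEnd : ∀ I {v} → Any (HasEnd v) (L I) → T (isLinkEnd I v)
Any⇒isLinkEnd I {v} h = any⁺ (isEndOf v) (Any.map (from (T-isEndOf⇔HasEnd v _)) h)

isInnerLinkEnd : (I : Instance) → Fin (n I) → Bool
isInnerLinkEnd I v = not (isLeaf I v) ∧ isLinkEnd I v

Leaf⇒¬isInnerLinkEnd : ∀ I {v} → Leaf I v → ¬ T (isInnerLinkEnd I v)
Leaf⇒¬isInnerLinkEnd I leaf h = subst (λ d → T (not (d ≡ᵇ 2))) leaf (proj₁ (to T-∧ h))

true≢false : true ≢ false
true≢false ()

module _ {I J : Instance} {S : Fin (n I) → Bool} (c : Contraction I S J) where
  open Contraction c

  φ-outside : ∀ {x y} → S x ≡ false → φ x ≡ φ y → x ≡ y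
  φ-outside Sx≡false φx≡φy with to (fibre _ _) φx≡φy
  ... | inj₁ x≡y = x≡y
  ... | inj₂ (Sx≡true , _) = ⊥-elim (true≢false (trans (sym Sx≡true) Sx≡false))

  φ-inside : ∀ {x y} → S x ≡ true → S y ≡ true → φ x ≡ φ y
  φ-inside Sx Sy = from (fibre _ _) (inj₂ (Sx , Sy))

  inside-closed : ∀ {x y} → S x ≡ true → φ y ≡ φ x → S y ≡ true
  inside-closed Sx φy≡φx with to (fibre _ _) φy≡φx
  ... | inj₁ refl = Sx
  ... | inj₂ (Sy , _) = Sy

  collapsed-inside : ∀ {x y} → x ≢ y → φ x ≡ φ y → S x ≡ true × S y ≡ true
  collapsed-inside x≢y φx≡φy with to (fibre _ _) φx≡φy
  ... | inj₁ x≡y = ⊥-elim (x≢y x≡y)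
  ... | inj₂ both = both

  incidence-outside : ∀ {x a} → S x ≡ false → incidence (φ x) (φ a) ≡ incidence x a
  incidence-outside {x} {a} Sx with φ a ≟F φ x | a ≟F x
  ... | yes _ | yes _ = refl
  ... | no _ | no _ = refl
  ... | yes φa≡φx | no a≢x = ⊥-elim (a≢x (sym (φ-outside Sx (sym φa≡φx))))
  ... | no φa≢φx | yes a≡x = ⊥-elim (φa≢φx (cong φ a≡x))

  incidence-inside : ∀ {x a} → S x ≡ true → incidence (φ x) (φ a) ≡ indicator (S a)
  incidence-inside {x} {a} Sx with φ a ≟F φ x | S a in Sa
  ... | yes _ | true = refl
  ... | no _ | false = refl
  ... | no φa≢φx | true = ⊥-elim (φa≢φx (φ-inside Sa Sx))
  ... | yes φa≡φx | false = ⊥-elim (true≢false (trans (sym (inside-closed Sx φa≡φx)) Sa))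

  rep : Fin (n J) → Fin (n I)
  rep y = proj₁ (surj y)

  φ-rep : ∀ y → φ (rep y) ≡ y
  φ-rep y = proj₂ (surj y)

  rep-injective : Injective _≡_ _≡_ rep
  rep-injective {y} {y′} rep-y≡rep-y′ = trans (sym (φ-rep y)) (trans (cong φ rep-y≡rep-y′) (φ-rep y′))

  isLinkEnd-outside : ∀ {x} → S x ≡ false → T (isLinkEnd J (φ x)) → T (isLinkEnd I x)
  isLinkEnd-outside {x} Sx h = Any⇒isLinkEnd I (Any.map pull (Any-contractList⁻ φ (L I) ends))
    where
    ends : Any (HasEnd (φ x)) (contractList φ (L I))
    ends = subst (Any (HasEnd (φ x))) links (isLinkEnd⇒Any J h)
    pull : ∀ {l} → HasEnd (φ x) (φ (proj₁ l) , φ (proj₂ l)) → HasEnd x l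
    pull = Sum.map (sym ∘ φ-outside Sx ∘ sym) (sym ∘ φ-outside Sx ∘ sym)

  contracted-loopless : Loopless (E J)
  contracted-loopless = subst Loopless (sym edges) (contractList-loopless φ (E I))

  module _ (loopless : Loopless (E I)) where

    deg-outside : ∀ {x} → S x ≡ false → deg J (φ x) ≡ deg I x
    deg-outside {x} Sx = begin
      deg J (φ x)                                     ≡⟨ deg≡sum-endsAt J (φ x) ⟩
      sum (map (endsAt (φ x)) (E J))                  ≡⟨ cong (sum ∘ map (endsAt (φ x))) edges ⟩
      sum (map (endsAt (φ x)) (contractList φ (E I))) ≡⟨ sum-map-contractList φ (endsAt x) (endsAt (φ x)) collapsed kept loopless ⟩
      sum (map (endsAt x) (E I))                      ≡⟨ deg≡sum-endsAt I x ⟨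
      deg I x                                         ∎
      where
      open ≡-Reasoning
      collapsed : ∀ {a b} → a ≢ b → φ a ≡ φ b → endsAt x (a , b) ≡ 0
      collapsed {a} {b} a≢b φa≡φb = cong₂ _+_
        (incidence-≢ {a = a} λ { refl → a≢b (φ-outside Sx φa≡φb) })
        (incidence-≢ {a = b} λ { refl → a≢b (sym (φ-outside Sx (sym φa≡φb))) })
      kept : ∀ {a b} → φ a ≢ φ b → endsAt (φ x) (φ a , φ b) ≡ endsAt x (a , b)
      kept _ = cong₂ _+_ (incidence-outside Sx) (incidence-outside Sx)

    deg-inside : ∀ {x} → S x ≡ true → deg J (φ x) ≡ cutSize I S
    deg-inside {x} Sx = begin
      deg J (φ x)                                     ≡⟨ deg≡sum-endsAt J (φ x) ⟩
      sum (map (endsAt (φ x)) (E J))                  ≡⟨ cong (sum ∘ map (endsAt (φ x))) edges ⟩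
      sum (map (endsAt (φ x)) (contractList φ (E I))) ≡⟨ sum-map-contractList φ (crosses S) (endsAt (φ x)) collapsed kept loopless ⟩
      sum (map (crosses S) (E I))                     ≡⟨ cutSize≡sum-crosses I S ⟨
      cutSize I S                                     ∎
      where
      open ≡-Reasoning
      collapsed : ∀ {a b} → a ≢ b → φ a ≡ φ b → crosses S (a , b) ≡ 0
      collapsed a≢b φa≡φb with collapsed-inside a≢b φa≡φb
      ... | Sa , Sb rewrite Sa | Sb = refl
      kept : ∀ {a b} → φ a ≢ φ b → endsAt (φ x) (φ a , φ b) ≡ crosses S (a , b)
      kept {a} {b} φa≢φb = trans (cong₂ _+_ (incidence-inside Sx) (incidence-inside Sx))
        (indicator-xor (S a) (S b) (λ Sa Sb → φa≢φb (φ-inside Sa Sb)))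

    isInnerLinkEnd-outside : ∀ {x} → S x ≡ false → T (isInnerLinkEnd J (φ x)) → T (isInnerLinkEnd I x)
    isInnerLinkEnd-outside Sx h with to T-∧ h
    ... | inner , end = from T-∧
      (subst (λ d → T (not (d ≡ᵇ 2))) (deg-outside Sx) inner , isLinkEnd-outside Sx end)

    ¬isInnerLinkEnd-inside : cutSize I S ≡ 2 → ∀ {x} → S x ≡ true → ¬ T (isInnerLinkEnd J (φ x))
    ¬isInnerLinkEnd-inside cut Sx = Leaf⇒¬isInnerLinkEnd J (trans (deg-inside Sx) cut)

    isInnerLinkEnd-rep : ∀ {y} → S (rep y) ≡ false → T (isInnerLinkEnd J y) → T (isInnerLinkEnd I (rep y))
    isInnerLinkEnd-rep {y} S-rep h = isInnerLinkEnd-outside S-rep (subst (T ∘ isInnerLinkEnd J) (sym (φ-rep y)) h)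

    f-contraction≤ : f J ≤ suc (f I)
    f-contraction≤ = begin
      f J                                                 ≡⟨ length-filterᵇ-partition (isInnerLinkEnd J) (S ∘ rep) (allFin (n J)) ⟩
      count (λ y → isInnerLinkEnd J y ∧ S (rep y))
        + count (λ y → isInnerLinkEnd J y ∧ not (S (rep y))) ≤⟨ +-mono-≤ (count-≤1 same) (count-≤-injection rep rep-injective outside) ⟩
      1 + f I                                             ∎
      where
      open ≤-Reasoning
      same : ∀ {y y′} → T (isInnerLinkEnd J y ∧ S (rep y)) → T (isInnerLinkEnd J y′ ∧ S (rep y′)) → y ≡ y′
      same h h′ = trans (sym (φ-rep _)) (trans (φ-inside (to T-≡ (proj₂ (to T-∧ h))) (to T-≡ (proj₂ (to T-∧ h′)))) (φ-rep _))
      outside : ∀ {y} → T (isInnerLinkEnd J y ∧ not (S (rep y))) → T (isInnerLinkEnd I (rep y))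
      outside h with to T-∧ h
      ... | inner , not-S = isInnerLinkEnd-rep (to T-not-≡ not-S) inner

    f-2-cut≤ : cutSize I S ≡ 2 → f J ≤ count (λ x → isInnerLinkEnd I x ∧ not (S x))
    f-2-cut≤ cut = count-≤-injection rep rep-injective outside
      where
      outside : ∀ {y} → T (isInnerLinkEnd J y) → T (isInnerLinkEnd I (rep y) ∧ not (S (rep y)))
      outside {y} h with S (rep y) in S-rep
      ... | true = ⊥-elim (¬isInnerLinkEnd-inside cut S-rep (subst (T ∘ isInnerLinkEnd J) (sym (φ-rep y)) h))
      ... | false = from T-∧ (isInnerLinkEnd-rep S-rep h , _)

f-split≤ : ∀ {I J₁ J₂} (C : Fin (n I) → Bool) → Loopless (E I) → cutSize I C ≡ 2 →
  Contraction I (λ x → not (C x)) J₁ → Contraction I C J₂ → f J₁ + f J₂ ≤ f I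
f-split≤ {I} {J₁} {J₂} C loopless cut c₁ c₂ = begin
  f J₁ + f J₂                   ≤⟨ +-mono-≤ (f-2-cut≤ c₁ loopless cut₁) (f-2-cut≤ c₂ loopless cut) ⟩
  count inside + count outside  ≡⟨ +-comm (count inside) (count outside) ⟩
  count outside + count inside  ≡⟨ length-filterᵇ-partition (isInnerLinkEnd I) (not ∘ C) (allFin (n I)) ⟨
  f I                           ∎
  where
  open ≤-Reasoning
  inside outside : Fin (n I) → Bool
  inside x = isInnerLinkEnd I x ∧ not (not (C x))
  outside x = isInnerLinkEnd I x ∧ not (C x)
  cut₁ : cutSize I (λ x → not (C x)) ≡ 2
  cut₁ = trans (cutSize-complement I C) cut

f-deleteLink≤ : ∀ I i → f (deleteLink I i) ≤ f I
f-deleteLink≤ I i = count-≤-injection {p = isInnerLinkEnd (deleteLink I i)} {q = isInnerLinkEnd I} id id still-inner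
  where
  still-inner : ∀ {x} → T (isInnerLinkEnd (deleteLink I i) x) → T (isInnerLinkEnd I x)
  still-inner {x} h with to T-∧ h
  ... | inner , end = from T-∧ (subst (λ d → T (not (d ≡ᵇ 2))) same-deg inner , Any⇒isLinkEnd I still-end)
    where
    still-end : Any (HasEnd x) (L I)
    still-end = Any-removeAt⁻ (L I) i (isLinkEnd⇒Any (deleteLink I i) end)
    same-deg : deg (deleteLink I i) x ≡ deg I x
    same-deg = trans (deg≡sum-endsAt (deleteLink I i) x) (sym (deg≡sum-endsAt I x))

sumF≤f+contractions : ∀ {k I} → Loopless (E I) → (σ : Splitting k I) → sumF σ ≤ f I + contractions σ
sumF≤f+contractions {I = I} _ (final _) = m≤m+n (f I) 0
sumF≤f+contractions {I = I} loopless (split {J₁ = J₁} {J₂} C cut c₁ c₂ σ τ) = begin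
  sumF σ + sumF τ                                     ≤⟨ +-mono-≤ (sumF≤f+contractions (contracted-loopless c₁) σ)
                                                                  (sumF≤f+contractions (contracted-loopless c₂) τ) ⟩
  (f J₁ + contractions σ) + (f J₂ + contractions τ)   ≡⟨ interchange +-commutativeSemigroup (f J₁) (contractions σ) (f J₂) (contractions τ) ⟩
  (f J₁ + f J₂) + (contractions σ + contractions τ)   ≤⟨ +-monoˡ-≤ _ (f-split≤ C loopless cut c₁ c₂) ⟩
  f I + (contractions σ + contractions τ)             ∎
  where open ≤-Reasoning
sumF≤f+contractions {I = I} loopless (contr {J = J} _ _ _ c σ) = begin
  sumF σ                   ≤⟨ sumF≤f+contractions (contracted-loopless c) σ ⟩
  f J + contractions σ     ≤⟨ +-monoˡ-≤ _ (f-contraction≤ c loopless) ⟩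
  suc (f I) + contractions σ ≡⟨ +-suc (f I) (contractions σ) ⟨
  f I + suc (contractions σ) ∎
  where open ≤-Reasoning
sumF≤f+contractions {I = I} loopless (delete i σ) = begin
  sumF σ                                ≤⟨ sumF≤f+contractions loopless σ ⟩
  f (deleteLink I i) + contractions σ   ≤⟨ +-monoˡ-≤ _ (f-deleteLink≤ I i) ⟩
  f I + contractions σ                  ∎
  where open ≤-Reasoning

suc-%-≢ : ∀ p t → t < suc (suc p) → suc t % suc (suc p) ≢ t
suc-%-≢ p t t<N with suc t <? suc (suc p)
... | yes 1+t<N = 1+n≢n ∘ trans (sym (m<n⇒m%n≡m 1+t<N))
... | no 1+t≮N with ≤-antisym t<N (≮⇒≥ 1+t≮N)
...   | refl = λ N%N≡1+p → 0≢1+n (trans (sym (n%n≡0 (suc (suc p)))) N%N≡1+p)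

next-≢ : ∀ I {p} (i : Fin (suc (suc p))) → next I i ≢ i
next-≢ I {p} i next≡i = suc-%-≢ p (toℕ i) (toℕ<n i) (trans (sym (toℕ-fromℕ< _)) (cong toℕ next≡i))

cycle-edge-not-loop : ∀ I (C : Cycle I) i →
  proj₁ (lookup (E I) (Cycle.es C i)) ≢ proj₂ (lookup (E I) (Cycle.es C i))
cycle-edge-not-loop I C i with Cycle.joins C i
... | inj₁ e rewrite e = λ eq → next-≢ I i (sym (Cycle.vsInj C eq))
... | inj₂ e rewrite e = λ eq → next-≢ I i (Cycle.vsInj C eq)

cactus-loopless : ∀ I → Cactus I → Loopless (E I)
cactus-loopless I (_ , in-cycle) = All.tabulate λ e∈ →
  subst (λ e → proj₁ e ≢ proj₂ e) (sym (lookup-index e∈)) (edge-not-loop (Any.index e∈))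
  where
  edge-not-loop : ∀ j → proj₁ (lookup (E I) j) ≢ proj₂ (lookup (E I) j)
  edge-not-loop j with proj₁ (in-cycle j)
  ... | C , i , refl = cycle-edge-not-loop I C i

isLinkEnd⇒Leaf : ∀ I → LeafToLeaf I → ∀ {v} → T (isLinkEnd I v) → Leaf I v
isLinkEnd⇒Leaf I leaves end with All.lookupAny leaves (isLinkEnd⇒Any I end)
... | (leaf₁ , _) , inj₁ end₁≡v = subst (Leaf I) end₁≡v leaf₁
... | (_ , leaf₂) , inj₂ end₂≡v = subst (Leaf I) end₂≡v leaf₂

f-leafToLeaf : ∀ I → LeafToLeaf I → f I ≡ 0
f-leafToLeaf I leaves = count-none {p = isInnerLinkEnd I} λ v h →
  Leaf⇒¬isInnerLinkEnd I (isLinkEnd⇒Leaf I leaves (proj₂ (to T-∧ h))) h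

lemma21 : (I : Instance) → Cactus I → LeafToLeaf I → (γ k : ℕ) → 1 ≤ k →
    (S : Splitting k I) → contractions S ≤ γ → sumF S ≤ γ
lemma21 I cactus leafToLeaf γ k _ σ contractions≤γ = begin
  sumF σ               ≤⟨ sumF≤f+contractions (cactus-loopless I cactus) σ ⟩
  f I + contractions σ ≡⟨ cong (_+ contractions σ) (f-leafToLeaf I leafToLeaf) ⟩
  contractions σ       ≤⟨ contractions≤γ ⟩
  γ                    ∎
  where open ≤-Reasoning
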